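{- Let $C$ be a configuration and let $s$ be a clearing sequence of $C$ that does not lose budget, and let $X$ be a set of virtual $2$-pieces with respect to $s$. Then the number of virtual $0$-pieces in the neighborhood of $X$ in the capture graph of $C$ is at least $|X|$.
   Context: A configuration is a finite set of pieces on distinct squares of a board, where either all pieces are kings or all pieces are knights, and each piece has a budget in $\{0,1,2\}$. A move: a piece with positive budget captures a piece it attacks (a king attacks squares $(x',y')$ with $\max(|x-x'|,|y-y'|)=1$ from $(x,y)$; a knight attacks squares with $\{|x-x'|,|y-y'|\}=\{1,2\}$), moving to the captured piece's square, removing it, and losing 1 budget. A capturing sequence clears $C$ if exactly one piece remains afterwards (the final piece). The capture graph of $C$ has the pieces as vertices, two pieces being adjacent iff they attack each other (ignoring budgets); the neighborhood of $X$ is the set of vertices outside $X$ adjacent to some vertex of $X$. With respect to $s$, a virtual $0$-piece is a piece that never moves from its original square during $s$, and all other pieces are virtual $2$-pieces; the virtual budget of a virtual $0$-piece is $0$ and that of a virtual $2$-piece is $2$. A clearing sequence loses budget if the budget of the final piece is strictly less than the sum of all virtual budgets minus the total number of captured pieces. -}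

module Defs where

open import Data.Bool using (Bool; true; false; _∧_; _∨_; not; T)
open import Data.Nat using (ℕ; zero; suc; _+_; _*_; _⊔_; _≡ᵇ_; _<_; _≤_)
open import Data.Integer using (ℤ; _-_; ∣_∣)
open import Data.Fin using (Fin; _≟_)
open import Data.Fin.Subset using (Subset)
open import Data.Product using (_×_; _,_; proj₁; Σ; ∃)
open import Data.List using (List; []; _∷_; length; allFin)
open import Data.Bool.ListAction using (any)
open import Data.Maybe using (Maybe; just; nothing)
open import Data.Vec using (tabulate; lookup)
open import Relation.Nullary using (¬_; does)
open import Relation.Binary.PropositionalEquality using (_≡_; _≢_)

Sq : Set
Sq = ℤ × ℤ

data Kind : Set where
  king knight : Kind

attacksᵇ : Kind → Sq → Sq → Bool
attacksᵇ king   (x , y) (x' , y') = (∣ x - x' ∣ ⊔ ∣ y - y' ∣) ≡ᵇ 1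
attacksᵇ knight (x , y) (x' , y') =
  ((∣ x - x' ∣ ≡ᵇ 1) ∧ (∣ y - y' ∣ ≡ᵇ 2)) ∨ ((∣ x - x' ∣ ≡ᵇ 2) ∧ (∣ y - y' ∣ ≡ᵇ 1))

record Config : Set where
  field
    n        : ℕ
    kind     : Kind
    pos      : Fin n → Sq
    pos-inj  : ∀ i j → pos i ≡ pos j → i ≡ j
    budget   : Fin n → ℕ
    budget≤2 : ∀ i → budget i ≤ 2
open Config public

-- A state: for each original piece, either removed (nothing) or its
-- current square and remaining budget.
State : ℕ → Set
State n = Fin n → Maybe (Sq × ℕ)

initial : (C : Config) → State (n C)
initial C i = just (pos C i , budget C i)

after : ∀ {n} → State n → Fin n → Fin n → Sq → ℕ → State n
after σ i j q b l with does (l ≟ i)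
... | true  = just (q , b)
... | false with does (l ≟ j)
...   | true  = nothing
...   | false = σ l

-- A move is a pair (capturer , captured).
Move : ℕ → Set
Move n = Fin n × Fin n

data Run {n : ℕ} (k : Kind) : State n → List (Move n) → State n → Set where
  done : ∀ {σ} → Run k σ [] σ
  step : ∀ {σ σ' i j p q b c s} →
         σ i ≡ just (p , suc b) →
         σ j ≡ just (q , c) →
         T (attacksᵇ k p q) →
         Run k (after σ i j q b) s σ' →
         Run k σ ((i , j) ∷ s) σ'

OnlyRemaining : ∀ {n} → State n → Fin n → ℕ → Set
OnlyRemaining σ f b = Σ Sq (λ p → σ f ≡ just (p , b)) × (∀ l → l ≢ f → σ l ≡ nothing)

Clears : (C : Config) → List (Move (n C)) → Fin (n C) → ℕ → Set
Clears C s f b = Σ (State (n C)) λ σ' → Run (kind C) (initial C) s σ' × OnlyRemaining σ' f b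

-- Virtual 2-pieces w.r.t. s: pieces that move (i.e. capture) at some point of s.
-- Virtual 0-pieces: the complement (never move from their original square).
virtual2 : ∀ {n} → List (Move n) → Subset n
virtual2 s = tabulate λ i → any (λ m → does (proj₁ m ≟ i)) s

virtual0 : ∀ {n} → List (Move n) → Subset n
virtual0 s = Data.Fin.Subset.∁ (virtual2 s)

virtualBudgetSum : ∀ {n} → List (Move n) → ℕ
virtualBudgetSum s = 2 * Data.Fin.Subset.∣ virtual2 s ∣

-- s loses budget: final budget b < (sum of virtual budgets) − (#captured pieces),
-- written without truncated subtraction.
LosesBudget : ∀ {n} → List (Move n) → ℕ → Set
LosesBudget s b = b + length s < virtualBudgetSum s

adjᵇ : (C : Config) → Fin (n C) → Fin (n C) → Bool
adjᵇ C i j = attacksᵇ (kind C) (pos C i) (pos C j) ∧ attacksᵇ (kind C) (pos C j) (pos C i)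

neighborhood : (C : Config) → Subset (n C) → Subset (n C)
neighborhood C X = tabulate λ l →
  not (lookup X l) ∧ any (λ x → lookup X x ∧ adjᵇ C x l) (allFin (n C))

{-# OPTIONS --safe #-}
-- Each capture spends one unit of the capturer's budget, so the initial budgets of the virtual
-- 2-pieces equal |s| + b + the budgets they still hold when captured. Not losing budget therefore
-- forces every virtual 2-piece to start with budget 2 and to be captured only with budget 0.
-- Send a virtual 2-piece x to the piece originally standing on the square of x's first capture:
-- that piece never moves (a vacated square stays empty forever) and is attacked from x's square.
-- Two pieces x, y with the same image are impossible: if x captured there first, x now holds one
-- unit and must be captured on that square without moving again for y to capture there.
module Submission where

open import Defs
open import Data.Nat using (ℕ; _≤_)
open import Data.List using (List)
open import Data.Fin using (Fin)
open import Data.Fin.Subset using (Subset; _⊆_; _∩_; ∣_∣)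
open import Relation.Nullary using (¬_)

open import Data.Nat using (zero; suc; _+_; _*_; z≤n; s≤s)
open import Data.Nat.Properties
  using ( +-0-commutativeMonoid; +-assoc; +-comm; *-comm; +-identityʳ; ≤-trans; ≤-antisym
        ; +-mono-≤; +-monoˡ-≤; +-monoʳ-≤; +-cancelˡ-≤; +-cancelʳ-≤; m≤m+n; ≮⇒≥; n≤0⇒n≡0
        ; m+n≡0⇒m≡0; m+n≡0⇒n≡0; module ≤-Reasoning )
open import Data.Nat.Tactic.RingSolver using (solve-∀)
open import Algebra.Properties.CommutativeMonoid.Sum +-0-commutativeMonoid
  using (sum; sum-remove; sum-cong-≗; sum-replicate-zero)
open import Data.Bool using (Bool; true; false; T; if_then_else_)
open import Data.Bool.Properties using (T-≡; T-∧; T-not-≡; ¬-not; if-eta)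
open import Data.Bool.ListAction using (any)
open import Data.Fin using (zero; suc; _≟_; punchIn)
open import Data.Fin.Properties using (suc-injective; punchInᵢ≢i; 0≢1+n)
open import Data.Fin.Subset using (_∈_; _∉_; _-_; inside; outside)
open import Data.Fin.Subset.Properties using (x∈p⇒∣p-x∣<∣p∣; x∈p∧x≢y⇒x∈p-y; x∉p⇒x∈∁p; x∈p∩q⁺)
open import Data.Integer.Properties using (∣i-j∣≡∣j-i∣; +-inverseʳ)
open import Data.List using ([]; _∷_; length)
open import Data.List.Membership.Propositional using (lose)
open import Data.List.Membership.Propositional.Properties using (∈-allFin)
open import Data.List.Relation.Unary.Any as Any using (Any; here; there)
open import Data.List.Relation.Unary.Any.Properties using (any⁺)
open import Data.Maybe using (Maybe; just; nothing)
open import Data.Product using (_×_; _,_; proj₁; proj₂; ∃-syntax; ∃₂)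
open import Data.Vec using ([]; _∷_; lookup; tabulate; here; there)
open import Data.Vec.Properties using (lookup∘tabulate; []=⇒lookup; lookup⇒[]=)
open import Function using (_∘_; Equivalence)
open import Relation.Nullary using (yes; no; does; contradiction)
open import Relation.Nullary.Decidable using (dec-true; dec-false)
open import Relation.Binary.PropositionalEquality

open Equivalence using (to; from)

sum-mono-≤ : ∀ {m} {f g : Fin m → ℕ} → (∀ l → f l ≤ g l) → sum f ≤ sum g
sum-mono-≤ {zero}  f≤g = z≤n
sum-mono-≤ {suc m} f≤g = +-mono-≤ (f≤g zero) (sum-mono-≤ (f≤g ∘ suc))

sum-excess-at : ∀ {m} {f g : Fin m → ℕ} a {d} →
                (∀ l → l ≢ a → f l ≡ g l) → f a ≡ d + g a → sum f ≡ d + sum g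
sum-excess-at {suc m} {f} {g} a {d} agree excess = begin
  sum f                           ≡⟨ sum-remove {i = a} f ⟩
  f a + sum (f ∘ punchIn a)       ≡⟨ cong₂ _+_ excess (sum-cong-≗ (λ l → agree _ (punchInᵢ≢i a l))) ⟩
  d + g a + sum (g ∘ punchIn a)   ≡⟨ +-assoc d (g a) _ ⟩
  d + (g a + sum (g ∘ punchIn a)) ≡⟨ cong (d +_) (sum-remove {i = a} g) ⟨
  d + sum g                       ∎
  where open ≡-Reasoning

sum-mono-≤-rigid : ∀ {m} {f g : Fin m → ℕ} → (∀ l → f l ≤ g l) → sum g ≤ sum f → ∀ l → f l ≡ g l
sum-mono-≤-rigid {suc m} {f} {g} f≤g g≤f l = ≤-antisym (f≤g l) (+-cancelʳ-≤ _ (g l) (f l) (begin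
  g l + sum (g ∘ punchIn l) ≡⟨ sum-remove {i = l} g ⟨
  sum g                     ≤⟨ g≤f ⟩
  sum f                     ≡⟨ sum-remove {i = l} f ⟩
  f l + sum (f ∘ punchIn l) ≤⟨ +-monoʳ-≤ (f l) (sum-mono-≤ (f≤g ∘ punchIn l)) ⟩
  f l + sum (g ∘ punchIn l) ∎))
  where open ≤-Reasoning

sum-indicator : ∀ {m} (p : Subset m) c → sum (λ l → if lookup p l then c else 0) ≡ ∣ p ∣ * c
sum-indicator []          c = refl
sum-indicator (true  ∷ p) c = cong (c +_) (sum-indicator p c)
sum-indicator (false ∷ p) c = sum-indicator p c

injectiveOn⇒∣p∣≤∣q∣ : ∀ {m m'} {p : Subset m} {q : Subset m'} (φ : Fin m → Fin m') →
                      (∀ {x} → x ∈ p → φ x ∈ q) →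
                      (∀ {x y} → x ∈ p → y ∈ p → φ x ≡ φ y → x ≡ y) →
                      ∣ p ∣ ≤ ∣ q ∣
injectiveOn⇒∣p∣≤∣q∣ {p = []} φ into injective = z≤n
injectiveOn⇒∣p∣≤∣q∣ {p = outside ∷ p} φ into injective =
  injectiveOn⇒∣p∣≤∣q∣ (φ ∘ suc) (into ∘ there)
    (λ x∈p y∈p eq → suc-injective (injective (there x∈p) (there y∈p) eq))
injectiveOn⇒∣p∣≤∣q∣ {p = inside ∷ p} {q} φ into injective =
  ≤-trans (s≤s (injectiveOn⇒∣p∣≤∣q∣ (φ ∘ suc) into-q-φ₀ injective-suc)) (x∈p⇒∣p-x∣<∣p∣ (into here))
  where
  into-q-φ₀ : ∀ {x} → x ∈ p → φ (suc x) ∈ q - φ zero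
  into-q-φ₀ x∈p = x∈p∧x≢y⇒x∈p-y (into (there x∈p)) (0≢1+n ∘ sym ∘ injective (there x∈p) here)
  injective-suc : ∀ {x y} → x ∈ p → y ∈ p → φ (suc x) ≡ φ (suc y) → x ≡ y
  injective-suc x∈p y∈p eq = suc-injective (injective (there x∈p) (there y∈p) eq)

balance-squeeze : ∀ {I K} L W b → I ≡ L + W + b → I ≤ K → K ≤ b + L → W ≡ 0 × K ≤ I
balance-squeeze {I} {K} L W b balance I≤K K≤b+L = n≤0⇒n≡0 (+-cancelˡ-≤ (b + L) W 0 W-bound) , K≤I
  where
  open ≤-Reasoning
  reorder : ∀ b L W → b + L + W ≡ L + W + b
  reorder = solve-∀
  W-bound : b + L + W ≤ b + L + 0
  W-bound = begin
    b + L + W ≡⟨ reorder b L W ⟩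
    L + W + b ≡⟨ balance ⟨
    I         ≤⟨ I≤K ⟩
    K         ≤⟨ K≤b+L ⟩
    b + L     ≡⟨ +-identityʳ _ ⟨
    b + L + 0 ∎
  K≤I : K ≤ I
  K≤I = begin
    K         ≤⟨ K≤b+L ⟩
    b + L     ≡⟨ +-comm b L ⟩
    L + b     ≤⟨ +-monoˡ-≤ b (m≤m+n L W) ⟩
    L + W + b ≡⟨ balance ⟨
    I         ∎

∈-tabulate⁺ : ∀ {m} {f : Fin m → Bool} {x} → T (f x) → x ∈ tabulate f
∈-tabulate⁺ {f = f} {x} t = lookup⇒[]= x _ (trans (lookup∘tabulate f x) (to T-≡ t))

∈-tabulate⁻ : ∀ {m} {f : Fin m → Bool} {x} → x ∈ tabulate f → T (f x)
∈-tabulate⁻ {f = f} {x} x∈ = from T-≡ (trans (sym (lookup∘tabulate f x)) ([]=⇒lookup x∈))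

attacks-irreflexive : ∀ k p → attacksᵇ k p p ≡ false
attacks-irreflexive king   (x , y) rewrite +-inverseʳ x | +-inverseʳ y = refl
attacks-irreflexive knight (x , y) rewrite +-inverseʳ x = refl

attacks-sym : ∀ k p q → attacksᵇ k p q ≡ attacksᵇ k q p
attacks-sym king   (x , y) (x' , y') rewrite ∣i-j∣≡∣j-i∣ x x' | ∣i-j∣≡∣j-i∣ y y' = refl
attacks-sym knight (x , y) (x' , y') rewrite ∣i-j∣≡∣j-i∣ x x' | ∣i-j∣≡∣j-i∣ y y' = refl

budgetOf : Maybe (Sq × ℕ) → ℕ
budgetOf nothing        = 0
budgetOf (just (_ , c)) = c

module _ {n : ℕ} where

  Moves : List (Move n) → Fin n → Set
  Moves s x = Any (λ m → proj₁ m ≡ x) s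

  Moves⇒∈virtual2 : ∀ {s x} → Moves s x → x ∈ virtual2 s
  Moves⇒∈virtual2 {s} {x} = ∈-tabulate⁺ ∘ any⁺ _ ∘ Any.map (λ {m} e → from T-≡ (dec-true (proj₁ m ≟ x) e))

  ∈virtual2⇒Moves : ∀ {s x} → x ∈ virtual2 s → Moves s x
  ∈virtual2⇒Moves {s} = go s ∘ ∈-tabulate⁻
    where
    go : ∀ s {x} → T (any (λ m → does (proj₁ m ≟ x)) s) → Moves s x
    go ((y , _) ∷ s) {x} t with y ≟ x
    ... | yes y≡x = here y≡x
    ... | no _    = there (go s t)

  Moves-tail : ∀ {i j s x} → Moves ((i , j) ∷ s) x → i ≢ x → Moves s x
  Moves-tail (here i≡x) i≢x = contradiction i≡x i≢x
  Moves-tail (there mv) _   = mv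

  after-capturer : ∀ (σ : State n) i j q b → after σ i j q b i ≡ just (q , b)
  after-capturer σ i j q b rewrite dec-true (i ≟ i) refl = refl

  after-captured : ∀ (σ : State n) {i j} q b → i ≢ j → after σ i j q b j ≡ nothing
  after-captured σ {i} {j} q b i≢j rewrite dec-false (j ≟ i) (i≢j ∘ sym) | dec-true (j ≟ j) refl = refl

  after-bystander : ∀ (σ : State n) {i j} q b {l} → l ≢ i → l ≢ j → after σ i j q b l ≡ σ l
  after-bystander σ {i} {j} q b {l} l≢i l≢j rewrite dec-false (l ≟ i) l≢i | dec-false (l ≟ j) l≢j = refl

  after-just⇒≢captured : ∀ (σ : State n) {i j} q b {l a} → i ≢ j → after σ i j q b l ≡ just a → l ≢ j
  after-just⇒≢captured σ q b i≢j σ₁l refl with () ← trans (sym σ₁l) (after-captured σ q b i≢j)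

  budgetOn : Subset n → State n → ℕ
  budgetOn M σ = sum λ l → if lookup M l then budgetOf (σ l) else 0

  budgetOn-step : ∀ {σ : State n} {i j p q b c} M →
                  σ i ≡ just (p , suc b) → σ j ≡ just (q , c) → i ≢ j → i ∈ M →
                  budgetOn M σ ≡ suc ((if lookup M j then c else 0) + budgetOn M (after σ i j q b))
  budgetOn-step {σ} {i} {j} {q = q} {b} {c} M σi σj i≢j i∈M =
    trans (sum-excess-at i capturer-agrees capturer-pays)
          (cong suc (sum-excess-at j captured-agrees captured-pays))
    where
    -- middle: i has paid for the capture but j is not yet removed
    before after′ middle : Fin n → ℕ
    before l = if lookup M l then budgetOf (σ l) else 0
    after′ l = if lookup M l then budgetOf (after σ i j q b l) else 0
    middle l = if does (l ≟ j) then before l else after′ l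

    capturer-agrees : ∀ l → l ≢ i → before l ≡ middle l
    capturer-agrees l l≢i with l ≟ j
    ... | yes _  = refl
    ... | no l≢j = cong (λ σl → if lookup M l then budgetOf σl else 0) (sym (after-bystander σ q b l≢i l≢j))

    capturer-pays : before i ≡ 1 + middle i
    capturer-pays rewrite dec-false (i ≟ j) i≢j | []=⇒lookup i∈M | σi | after-capturer σ i j q b = refl

    captured-agrees : ∀ l → l ≢ j → middle l ≡ after′ l
    captured-agrees l l≢j rewrite dec-false (l ≟ j) l≢j = refl

    captured-pays : middle j ≡ (if lookup M j then c else 0) + after′ j
    captured-pays rewrite dec-true (j ≟ j) refl | after-captured σ q b i≢j | σj with lookup M j
    ... | true  = sym (+-identityʳ c)
    ... | false = refl

  budgetOn-only : ∀ {σ : State n} {f b} M → OnlyRemaining σ f b → f ∈ M → budgetOn M σ ≡ b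
  budgetOn-only {σ} {f} {b} M ((_ , σf) , others) f∈M = begin
    budgetOn M σ                ≡⟨ sum-excess-at f others-empty final ⟩
    b + sum (λ (_ : Fin n) → 0) ≡⟨ cong (b +_) (sum-replicate-zero n) ⟩
    b + 0                       ≡⟨ +-identityʳ b ⟩
    b                           ∎
    where
    open ≡-Reasoning
    others-empty : ∀ l → l ≢ f → (if lookup M l then budgetOf (σ l) else 0) ≡ 0
    others-empty l l≢f rewrite others l l≢f = if-eta (lookup M l)
    final : (if lookup M f then budgetOf (σ f) else 0) ≡ b + 0
    final rewrite []=⇒lookup f∈M | σf = sym (+-identityʳ b)

  FullMover : State n → List (Move n) → Fin n → Set
  FullMover σ s x = Moves s x × ∃[ p ] σ x ≡ just (p , 2)

module _ {n : ℕ} {k : Kind} where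

  capturer≢captured : ∀ {σ : State n} {i j p q b c} →
                      σ i ≡ just (p , suc b) → σ j ≡ just (q , c) → T (attacksᵇ k p q) → i ≢ j
  capturer≢captured {p = p} σi σj attack refl with refl ← trans (sym σi) σj =
    subst T (attacks-irreflexive k p) attack

  removed-stays-removed : ∀ {σ : State n} {s σ' x} → Run k σ s σ' → σ x ≡ nothing → σ' x ≡ nothing × ¬ Moves s x
  removed-stays-removed done σx = σx , λ ()
  removed-stays-removed {σ} {x = x} (step {σ' = σ'} {i} {j} {q = q} {b} {s = s} σi σj attack r) σx =
    proj₁ later , λ { (here i≡x) → i≢x i≡x ; (there mv) → proj₂ later mv }
    where
    i≢x : i ≢ x
    i≢x refl with () ← trans (sym σi) σx
    σ₁x : after σ i j q b x ≡ nothing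
    σ₁x with x ≟ j
    ... | yes refl = after-captured σ q b i≢x
    ... | no x≢j   = trans (after-bystander σ q b (i≢x ∘ sym) x≢j) σx
    later : σ' x ≡ nothing × ¬ Moves s x
    later = removed-stays-removed r σ₁x

  captured-stays-removed : ∀ {σ : State n} {i j s σ'} → Run k σ ((i , j) ∷ s) σ' →
                           σ' j ≡ nothing × ¬ Moves ((i , j) ∷ s) j
  captured-stays-removed {σ} {i} {j} {s} {σ'} (step {q = q} {b = b} σi σj attack r) =
    proj₁ later , λ { (here i≡j) → i≢j i≡j ; (there mv) → proj₂ later mv }
    where
    i≢j : i ≢ j
    i≢j = capturer≢captured σi σj attack
    later : σ' j ≡ nothing × ¬ Moves s j
    later = removed-stays-removed r (after-captured σ q b i≢j)

  mover≢captured : ∀ {σ : State n} {i j s σ' x} → Run k σ ((i , j) ∷ s) σ' → Moves ((i , j) ∷ s) x → x ≢ j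
  mover≢captured r mv refl = proj₂ (captured-stays-removed r) mv

  some-capturer-survives : ∀ {σ : State n} {m s σ'} → Run k σ (m ∷ s) σ' → ∃[ x ] Moves (m ∷ s) x × σ' x ≢ nothing
  some-capturer-survives {s = []} (step {σ} {i = i} {j} {q = q} {b = b} _ _ _ done) =
    i , here refl , λ σ'i → contradiction (trans (sym (after-capturer σ i j q b)) σ'i) λ ()
  some-capturer-survives {s = _ ∷ _} (step _ _ _ r) with some-capturer-survives r
  ... | x , mv , alive = x , there mv , alive

  capturedBudgetOn : ∀ {σ : State n} {s σ'} → Subset n → Run k σ s σ' → ℕ
  capturedBudgetOn M done = 0
  capturedBudgetOn M (step {j = j} {c = c} _ _ _ r) = (if lookup M j then c else 0) + capturedBudgetOn M r

  budgetOn-run : ∀ {σ : State n} {s σ'} M (r : Run k σ s σ') → (∀ {x} → Moves s x → x ∈ M) →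
                 budgetOn M σ ≡ length s + capturedBudgetOn M r + budgetOn M σ'
  budgetOn-run M done _ = refl
  budgetOn-run {σ} M (step {σ' = σ'} {i} {j} {q = q} {b} {c} {s} σi σj attack r) movers⊆M = begin
    budgetOn M σ
      ≡⟨ budgetOn-step M σi σj (capturer≢captured σi σj attack) (movers⊆M (here refl)) ⟩
    suc (w + budgetOn M (after σ i j q b)) ≡⟨ cong (λ t → suc (w + t)) (budgetOn-run M r (movers⊆M ∘ there)) ⟩
    suc (w + (length s + W + B))           ≡⟨ regroup w (length s) W B ⟩
    suc (length s) + (w + W) + B           ∎
    where
    open ≡-Reasoning
    w W B : ℕ
    w = if lookup M j then c else 0
    W = capturedBudgetOn M r
    B = budgetOn M σ'
    regroup : ∀ w l W B → suc (w + (l + W + B)) ≡ suc l + (w + W) + B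
    regroup = solve-∀

  removed-without-moving⇒budget≡0 :
    ∀ {σ : State n} {s σ' x p c} M (r : Run k σ s σ') → capturedBudgetOn M r ≡ 0 → x ∈ M →
    σ x ≡ just (p , c) → ¬ Moves s x → σ' x ≡ nothing → c ≡ 0
  removed-without-moving⇒budget≡0 M done _ _ σx _ σ'x with () ← trans (sym σx) σ'x
  removed-without-moving⇒budget≡0 {σ} {x = x} M (step {j = j} {q = q} {b} {c′} _ σj _ r) W≡0 x∈M σx unmoved σ'x
    with j ≟ x
  ... | yes refl with refl ← trans (sym σj) σx =
    subst (λ m → (if m then c′ else 0) ≡ 0) ([]=⇒lookup x∈M) (m+n≡0⇒m≡0 _ W≡0)
  ... | no j≢x =
    removed-without-moving⇒budget≡0 M r (m+n≡0⇒n≡0 _ W≡0) x∈M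
      (trans (after-bystander σ q b (unmoved ∘ here ∘ sym) (j≢x ∘ sym)) σx) (unmoved ∘ there) σ'x

  -- The piece originally standing on the square where x makes its first capture (x itself if x
  -- never captures): if x first captures on the square of the current capturer i, it was j's.
  firstTarget : ∀ {σ : State n} {s σ'} → Run k σ s σ' → Fin n → Fin n
  firstTarget done x = x
  firstTarget (step {i = i} {j} _ _ _ r) x with x ≟ i | firstTarget r x ≟ i
  ... | yes _ | _     = j
  ... | no _  | yes _ = j
  ... | no _  | no _  = firstTarget r x

  data FirstTargetStep (i j x t : Fin n) : Fin n → Set where
    is-capturer   : x ≡ i → FirstTargetStep i j x t j
    onto-capturer : x ≢ i → t ≡ i → FirstTargetStep i j x t j
    elsewhere     : x ≢ i → t ≢ i → FirstTargetStep i j x t t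

  firstTarget-step : ∀ {σ : State n} {i j p q b c s σ'} (σi : σ i ≡ just (p , suc b)) (σj : σ j ≡ just (q , c))
                     (attack : T (attacksᵇ k p q)) (r : Run k (after σ i j q b) s σ') x →
                     FirstTargetStep i j x (firstTarget r x) (firstTarget (step σi σj attack r) x)
  firstTarget-step {i = i} σi σj attack r x with x ≟ i | firstTarget r x ≟ i
  ... | yes x≡i | _       = is-capturer x≡i
  ... | no x≢i  | yes t≡i = onto-capturer x≢i t≡i
  ... | no x≢i  | no t≢i  = elsewhere x≢i t≢i

  firstTarget-unmoved : ∀ {σ : State n} {s σ' x} (r : Run k σ s σ') → Moves s x →
                        σ' (firstTarget r x) ≡ nothing × ¬ Moves s (firstTarget r x)
  firstTarget-unmoved {x = x} r₀@(step σi σj attack r) mv with firstTarget r₀ x | firstTarget-step σi σj attack r x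
  ... | _ | is-capturer _     = captured-stays-removed r₀
  ... | _ | onto-capturer _ _ = captured-stays-removed r₀
  ... | _ | elsewhere x≢i t≢i with firstTarget-unmoved r (Moves-tail mv (x≢i ∘ sym))
  ...   | σ't , unmoved = σ't , λ { (here i≡t) → t≢i (sym i≡t) ; (there mv′) → unmoved mv′ }

  firstTarget-attacked : ∀ {σ : State n} {s σ' x p c} (r : Run k σ s σ') → Moves s x → σ x ≡ just (p , c) →
                         ∃₂ λ q d → σ (firstTarget r x) ≡ just (q , d) × T (attacksᵇ k p q)
  firstTarget-attacked {σ} {x = x} r₀@(step {i = i} {j} {q = q} {b} {c} σi σj attack r) mv σx
    with firstTarget r₀ x | firstTarget-step σi σj attack r x
  ... | _ | is-capturer refl with refl ← trans (sym σi) σx = q , c , σj , attack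
  ... | _ | onto-capturer x≢i t≡i
    with _ , _ , σ₁t , attack′ ← firstTarget-attacked r (Moves-tail mv (x≢i ∘ sym))
                                   (trans (after-bystander σ q b x≢i (mover≢captured r₀ mv)) σx)
    with refl ← trans (sym σ₁t) (trans (cong (after σ i j q b) t≡i) (after-capturer σ i j q b)) =
    q , c , σj , attack′
  ... | _ | elsewhere x≢i t≢i
    with q′ , d , σ₁t , attack′ ← firstTarget-attacked r (Moves-tail mv (x≢i ∘ sym))
                                    (trans (after-bystander σ q b x≢i (mover≢captured r₀ mv)) σx) =
    q′ , d , trans (sym (after-bystander σ q b t≢i t≢j)) σ₁t , attack′
    where
    t≢j : firstTarget r x ≢ j
    t≢j = after-just⇒≢captured σ q b (capturer≢captured σi σj attack) σ₁t

  firstTarget-injective : ∀ {σ : State n} {s σ' x y} M (r : Run k σ s σ') → capturedBudgetOn M r ≡ 0 →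
                          (∀ {z} → Moves s z → z ∈ M) → FullMover σ s x → FullMover σ s y →
                          firstTarget r x ≡ firstTarget r y → x ≡ y
  firstTarget-injective {x = x} {y} M r₀@(step {σ} {σ'} {i} {j} {q = q} {b} {s = s} σi σj attack r)
                        W≡0 movers⊆M full-x full-y = go
    where
    σ₁ : State n
    σ₁ = after σ i j q b
    W′≡0 : capturedBudgetOn M r ≡ 0
    W′≡0 = m+n≡0⇒n≡0 _ W≡0

    full-tail : ∀ {z} → FullMover σ ((i , j) ∷ s) z → z ≢ i → FullMover σ₁ s z
    full-tail (mv , p , σz) z≢i =
      Moves-tail mv (z≢i ∘ sym) , p , trans (after-bystander σ q b z≢i (mover≢captured r₀ mv)) σz

    target≢j : ∀ {z} → FullMover σ₁ s z → firstTarget r z ≢ j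
    target≢j (mv , _ , σ₁z) with _ , _ , σ₁t , _ ← firstTarget-attacked r mv σ₁z =
      after-just⇒≢captured σ q b (capturer≢captured σi σj attack) σ₁t

    -- i keeps one unit after this capture; being captured later without moving would waste it
    target≢i : FullMover σ ((i , j) ∷ s) i → ∀ {z} → FullMover σ₁ s z → firstTarget r z ≢ i
    target≢i (_ , _ , σi≡2) (mv , _) t≡i with σ't , unmoved ← firstTarget-unmoved r mv =
      contradiction (trans (cong suc (sym spent)) (cong budgetOf (trans (sym σi) σi≡2))) λ ()
      where
      spent : b ≡ 0
      spent = removed-without-moving⇒budget≡0 M r W′≡0 (movers⊆M (here refl)) (after-capturer σ i j q b)
                (subst (¬_ ∘ Moves s) t≡i unmoved) (subst (λ t → σ' t ≡ nothing) t≡i σ't)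

    IH : ∀ {x y} → FullMover σ₁ s x → FullMover σ₁ s y → firstTarget r x ≡ firstTarget r y → x ≡ y
    IH = firstTarget-injective M r W′≡0 (movers⊆M ∘ there)

    full-i : ∀ {z} → z ≡ i → FullMover σ ((i , j) ∷ s) z → FullMover σ ((i , j) ∷ s) i
    full-i refl full = full

    go : firstTarget r₀ x ≡ firstTarget r₀ y → x ≡ y
    go eq with firstTarget r₀ x | firstTarget-step σi σj attack r x | firstTarget r₀ y | firstTarget-step σi σj attack r y
    ... | _ | is-capturer x≡i       | _ | is-capturer y≡i       = trans x≡i (sym y≡i)
    ... | _ | is-capturer x≡i       | _ | onto-capturer y≢i u≡i =
      contradiction u≡i (target≢i (full-i x≡i full-x) (full-tail full-y y≢i))
    ... | _ | onto-capturer x≢i t≡i | _ | is-capturer y≡i       =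
      contradiction t≡i (target≢i (full-i y≡i full-y) (full-tail full-x x≢i))
    ... | _ | onto-capturer x≢i t≡i | _ | onto-capturer y≢i u≡i =
      IH (full-tail full-x x≢i) (full-tail full-y y≢i) (trans t≡i (sym u≡i))
    ... | _ | is-capturer _         | _ | elsewhere y≢i _       = contradiction (sym eq) (target≢j (full-tail full-y y≢i))
    ... | _ | onto-capturer _ _     | _ | elsewhere y≢i _       = contradiction (sym eq) (target≢j (full-tail full-y y≢i))
    ... | _ | elsewhere x≢i _       | _ | is-capturer _         = contradiction eq (target≢j (full-tail full-x x≢i))
    ... | _ | elsewhere x≢i _       | _ | onto-capturer _ _     = contradiction eq (target≢j (full-tail full-x x≢i))
    ... | _ | elsewhere x≢i _       | _ | elsewhere y≢i _       = IH (full-tail full-x x≢i) (full-tail full-y y≢i) eq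

  final-piece-moves : ∀ {σ : State n} {m s σ' f b} → Run k σ (m ∷ s) σ' → OnlyRemaining σ' f b → Moves (m ∷ s) f
  final-piece-moves {f = f} r (_ , others) with some-capturer-survives r
  ... | x , mv , alive with x ≟ f
  ...   | yes refl = mv
  ...   | no x≢f   = contradiction (others x x≢f) alive

¬LosesBudget⇒tight : ∀ {C s σ' f b} (r : Run (kind C) (initial C) s σ') → OnlyRemaining σ' f b → ¬ LosesBudget s b →
                    capturedBudgetOn (virtual2 s) r ≡ 0 × (∀ {x} → x ∈ virtual2 s → budget C x ≡ 2)
¬LosesBudget⇒tight done _ _ = refl , λ x∈ → contradiction (∈virtual2⇒Moves {s = []} x∈) λ ()
¬LosesBudget⇒tight {C} {s} {b = b} r@(step _ _ _ _) only notLosing = proj₁ squeezed , full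
  where
  M : Subset (n C)
  M = virtual2 s
  W : ℕ
  W = capturedBudgetOn M r
  initialBudgets capacities : Fin (n C) → ℕ
  initialBudgets l = if lookup M l then budget C l else 0
  capacities     l = if lookup M l then 2 else 0

  initial≤capacity : ∀ l → initialBudgets l ≤ capacities l
  initial≤capacity l with lookup M l
  ... | true  = budget≤2 C l
  ... | false = z≤n

  balance : sum initialBudgets ≡ length s + W + b
  balance = trans (budgetOn-run M r Moves⇒∈virtual2)
                  (cong (length s + W +_) (budgetOn-only M only (Moves⇒∈virtual2 (final-piece-moves r only))))

  capacity≤ : sum capacities ≤ b + length s
  capacity≤ = begin
    sum capacities     ≡⟨ sum-indicator M 2 ⟩
    ∣ M ∣ * 2          ≡⟨ *-comm ∣ M ∣ 2 ⟩
    virtualBudgetSum s ≤⟨ ≮⇒≥ notLosing ⟩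
    b + length s       ∎
    where open ≤-Reasoning

  squeezed : W ≡ 0 × sum capacities ≤ sum initialBudgets
  squeezed = balance-squeeze (length s) W b balance (sum-mono-≤ initial≤capacity) capacity≤

  full : ∀ {x} → x ∈ M → budget C x ≡ 2
  full {x} x∈M = subst (λ m → (if m then budget C x else 0) ≡ (if m then 2 else 0)) ([]=⇒lookup x∈M)
                   (sum-mono-≤-rigid initial≤capacity (proj₂ squeezed) x)

attacks⇒∈neighborhood : ∀ C {X x y} → x ∈ X → y ∉ X → T (attacksᵇ (kind C) (pos C x) (pos C y)) →
                        y ∈ neighborhood C X
attacks⇒∈neighborhood C {X} {x} {y} x∈X y∉X attack =
  ∈-tabulate⁺ (from T-∧ (from T-not-≡ y-outside , any⁺ _ (lose (∈-allFin x) (from T-∧ (x-inside , adjacent)))))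
  where
  x-inside : T (lookup X x)
  x-inside = from T-≡ ([]=⇒lookup x∈X)
  y-outside : lookup X y ≡ false
  y-outside = ¬-not (y∉X ∘ lookup⇒[]= y X)
  adjacent : T (adjᵇ C x y)
  adjacent = from T-∧ (attack , subst T (attacks-sym (kind C) (pos C x) (pos C y)) attack)

lemma3 : (C : Config) (s : List (Move (n C))) (f : Fin (n C)) (b : ℕ) →
           Clears C s f b → ¬ LosesBudget s b →
           (X : Subset (n C)) → X ⊆ virtual2 s →
           ∣ X ∣ ≤ ∣ virtual0 s ∩ neighborhood C X ∣
lemma3 C s f b (_ , r , only) notLosing X X⊆virtual2 =
  injectiveOn⇒∣p∣≤∣q∣ (firstTarget r) target∈
    (λ x∈X y∈X → firstTarget-injective (virtual2 s) r (proj₁ tight) Moves⇒∈virtual2 (full x∈X) (full y∈X))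
  where
  tight : capturedBudgetOn (virtual2 s) r ≡ 0 × (∀ {x} → x ∈ virtual2 s → budget C x ≡ 2)
  tight = ¬LosesBudget⇒tight {C} r only notLosing

  moves : ∀ {x} → x ∈ X → Moves s x
  moves = ∈virtual2⇒Moves ∘ X⊆virtual2

  full : ∀ {x} → x ∈ X → FullMover (initial C) s x
  full {x} x∈X = moves x∈X , pos C x , cong (λ c → just (pos C x , c)) (proj₂ tight (X⊆virtual2 x∈X))

  target∈ : ∀ {x} → x ∈ X → firstTarget r x ∈ virtual0 s ∩ neighborhood C X
  target∈ {x} x∈X with _ , _ , refl , attack ← firstTarget-attacked r (moves x∈X) refl =
    x∈p∩q⁺ (x∉p⇒x∈∁p unmoved , attacks⇒∈neighborhood C x∈X (unmoved ∘ X⊆virtual2) attack)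
    where
    unmoved : firstTarget r x ∉ virtual2 s
    unmoved = proj₂ (firstTarget-unmoved r (moves x∈X)) ∘ ∈virtual2⇒Moves
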